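{- Let $\mathcal{H}$ be a fixed finite set of connected graphs each of diameter at most $D$, let $\Delta>1$, and let $(G,k)$ be a yes-instance of $\mathcal{H}$-free Edge Deletion where $G$ has maximum degree at most $\Delta$ and contains at least one induced copy of a member of $\mathcal{H}$. Let $G'$ be obtained from $G$ by deleting all vertices at distance more than $(1+\log_{\frac{2\Delta}{2\Delta-1}}k)D$ from $V_{\mathcal{H}}(G)$. Then $|V(G')|\le 2\Delta^{2D+1}\cdot k^{pD+1}$, where $p=\log_{\frac{2\Delta}{2\Delta-1}}\Delta$.
   Context: All graphs are finite and simple. A graph is $\mathcal{H}$-free if it has no induced subgraph isomorphic to a member of $\mathcal{H}$. $\mathcal{H}$-free Edge Deletion: given $G$ and a positive integer $k$, decide whether some $E'\subseteq E(G)$ with $|E'|\le k$ makes $G\setminus E'=(V(G),E(G)\setminus E')$ $\mathcal{H}$-free. $V_{\mathcal{H}}(G)$ is the set of vertices of $G$ lying in some induced copy of a member of $\mathcal{H}$. The distance from a vertex to a vertex set is the minimum distance to its elements. -}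

module Defs where

open import Data.Nat using (ℕ; zero; suc; _+_; _*_; _∸_; _^_; _≤_; _<_)
open import Data.Fin using (Fin)
open import Data.Product using (Σ; ∃; ∃-syntax; _×_; _,_)
open import Data.List using (List; length)
open import Data.List.Membership.Propositional using (_∈_)
open import Data.List.Relation.Unary.All using (All)
open import Data.List.Relation.Unary.Unique.Propositional using (Unique)
open import Function.Definitions using (Injective)
open import Relation.Nullary using (¬_)
open import Relation.Binary.PropositionalEquality using (_≡_)

record Graph (n : ℕ) : Set₁ where
  field
    E      : Fin n → Fin n → Set
    E-sym  : ∀ {i j} → E i j → E j i
    E-irr  : ∀ {i} → ¬ E i i
open Graph public

data Walk {n} (G : Graph n) : Fin n → Fin n → ℕ → Set where
  here  : ∀ {u} → Walk G u u zero
  step  : ∀ {u v w ℓ} → E G u v → Walk G v w ℓ → Walk G u w (suc ℓ)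

DistLe : ∀ {n} → Graph n → Fin n → Fin n → ℕ → Set
DistLe G u v d = ∃[ ℓ ] (ℓ ≤ d × Walk G u v ℓ)

Connected : ∀ {n} → Graph n → Set
Connected {n} G = (1 ≤ n) × (∀ u v → ∃[ ℓ ] Walk G u v ℓ)

DiamLe : ∀ {n} → Graph n → ℕ → Set
DiamLe G D = ∀ u v → DistLe G u v D

MaxDegLe : ∀ {n} → Graph n → ℕ → Set
MaxDegLe {n} G Δ = ∀ (v : Fin n) (l : List (Fin n)) → Unique l → All (E G v) l → length l ≤ Δ

Family : Set₁
Family = List (Σ ℕ Graph)

InducedCopy : ∀ {m n} → Graph m → Graph n → Set
InducedCopy {m} {n} H G =
  Σ (Fin m → Fin n) λ f → Injective _≡_ _≡_ f ×
    (∀ i j → (E H i j → E G (f i) (f j)) × (E G (f i) (f j) → E H i j))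

Free : Family → ∀ {n} → Graph n → Set₁
Free ℋ G = ∀ {m} (H : Graph m) → (m , H) ∈ ℋ → ¬ InducedCopy H G

-- G ∖ F for a list F of (ordered representatives of) edges
deleteEdges : ∀ {n} → Graph n → List (Fin n × Fin n) → Graph n
deleteEdges G F = record
  { E     = λ i j → E G i j × ¬ ((i , j) ∈ F) × ¬ ((j , i) ∈ F)
  ; E-sym = λ { (e , p , q) → E-sym G e , q , p }
  ; E-irr = λ { (e , _ , _) → E-irr G e }
  }

YesInstance : Family → ∀ {n} → Graph n → ℕ → Set₁
YesInstance ℋ {n} G k =
  ∃[ F ] (All (λ p → E G (Data.Product.proj₁ p) (Data.Product.proj₂ p)) F
         × length F ≤ k × Free ℋ (deleteEdges G F))

InVH : Family → ∀ {n} → Graph n → Fin n → Set₁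
InVH ℋ G v = ∃[ m ] Σ (Graph m) λ H → (m , H) ∈ ℋ ×
  Σ (InducedCopy H G) λ c → ∃[ i ] (Data.Product.proj₁ c i ≡ v)

-- d > (1 + log_b k)·D  with  b = 2Δ/(2Δ-1), written in integer arithmetic:
-- D < d  and  b^(d-D) > k^D, i.e. k^D·(2Δ-1)^(d-D) < (2Δ)^(d-D).
TooFar : ℕ → ℕ → ℕ → ℕ → Set
TooFar Δ k D d = D < d × (k ^ D) * ((2 * Δ ∸ 1) ^ (d ∸ D)) < (2 * Δ) ^ (d ∸ D)

Kept : Family → ∀ {n} → Graph n → ℕ → ℕ → ℕ → Fin n → Set₁
Kept ℋ G Δ k D v = ∃[ d ] ∃[ w ] (InVH ℋ G w × DistLe G v w d × ¬ TooFar Δ k D d)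

-- N ≤ 2Δ^(2D+1) · k^(pD+1),  p = log_b Δ, b = 2Δ/(2Δ-1), written as:
-- N/M ≤ Δ^(D·log_b k) with M = 2Δ^(2D+1)·k, i.e. for all naturals r, s>0,
-- Δ^(D r/s) < N/M  implies  r/s < log_b k  (i.e. b^r < k^s).
BoundHolds : ℕ → ℕ → ℕ → ℕ → Set
BoundHolds Δ k D N =
  ∀ (r s : ℕ) → 1 ≤ s →
    (Δ ^ (D * r)) * ((2 * Δ ^ (2 * D + 1) * k) ^ s) < N ^ s →
    (2 * Δ) ^ r < (k ^ s) * ((2 * Δ ∸ 1) ^ r)

{-# OPTIONS --safe #-}
-- Fix a solution F with |F| ≤ k. An induced copy of a member of ℋ avoiding every endpoint of
-- F would survive in G ∖ F, so every copy contains an endpoint of F and, having diameter ≤ D,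
-- puts all its vertices within distance D of that endpoint. Hence G' lies in the 2k balls of
-- radius D + R around the endpoints of F, where R ≤ (1 + log_b k) D, b = 2Δ/(2Δ−1), is the
-- largest distance to V_ℋ(G) of a vertex of G'. A ball of radius ρ has at most
-- 1 + Δ + ⋯ + Δ^ρ < Δ^(ρ+1) vertices, so |V(G')| ≤ 2k Δ^(2D+1) Δ^(D log_b k) = 2Δ^(2D+1) k^(pD+1).
module Submission where

open import Defs
open import Data.Nat using (ℕ; _≤_)
open import Data.Fin using (Fin)
open import Data.Product using (Σ; ∃; ∃-syntax; _×_; _,_)
open import Data.List using (List; length)
open import Data.List.Membership.Propositional using (_∈_)
open import Data.List.Relation.Unary.All using (All)
open import Data.List.Relation.Unary.Unique.Propositional using (Unique)

open import Data.Empty using (⊥-elim)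
open import Data.Fin.Properties using (_≟_) renaming (any? to Fin-any?)
open import Data.List using ([]; _∷_; deduplicate)
open import Data.List.Relation.Binary.Sublist.Propositional using ([]; _∷_; _∷ʳ_; _⊆_; _⊇_)
open import Data.List.Relation.Binary.Sublist.Propositional.Properties using (All-resp-⊆)
open import Data.List.Relation.Unary.All using ([]; _∷_)
open import Data.List.Relation.Unary.Any using (Any; here; there)
open import Data.List.Relation.Unary.AllPairs using ([]; _∷_)
open import Data.Nat using (zero; suc; _+_; _*_; _∸_; _^_; _<_; _⊔_; s≤s; z≤n; NonZero; >-nonZero; _<?_)
open import Data.Nat.Properties hiding (_≟_)
open import Algebra.Properties.CommutativeSemigroup *-commutativeSemigroup using (xy∙z≈xz∙y; x∙yz≈y∙xz)
open import Data.Nat.Tactic.RingSolver using (solve-∀)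
open import Data.Product using (proj₁; proj₂)
open import Data.Sum using (_⊎_; inj₁; inj₂; [_,_]′)
open import Function using (id)
open import Relation.Binary.Definitions using (DecidableEquality; _Respects_)
open import Relation.Binary.PropositionalEquality using (_≡_; refl; sym; trans; cong; subst; subst₂; module ≡-Reasoning)
open import Relation.Nullary using (¬_; yes; no)
open import Relation.Nullary.Decidable using (_⊎-dec_)
open import Relation.Unary using (_∪_)

import Data.List.Relation.Unary.All as All
import Data.List.Relation.Unary.All.Properties as All
import Data.List.Relation.Unary.Any as Any
import Data.List.Relation.Unary.Any.Properties as Any
import Data.List.Relation.Unary.Unique.DecPropositional.Properties as Unique

Unique-resp-⊆ : {A : Set} → Unique {A = A} Respects _⊇_
Unique-resp-⊆ []          []            = []
Unique-resp-⊆ (_ ∷ʳ σ)    (_ ∷ u)       = Unique-resp-⊆ σ u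
Unique-resp-⊆ (refl ∷ σ)  (x∉xs ∷ u)    = All-resp-⊆ σ x∉xs ∷ Unique-resp-⊆ σ u

module _ {A : Set} {P Q : A → Set} where

  partition-All : ∀ {xs} → All (P ∪ Q) xs →
                  ∃[ ys ] ∃[ zs ] ys ⊆ xs × zs ⊆ xs × length xs ≡ length ys + length zs ×
                                  All P ys × All Q zs
  partition-All [] = [] , [] , [] , [] , refl , [] , []
  partition-All {x ∷ _} (inj₁ px ∷ pqs) =
    let ys , zs , σ , τ , len , ps , qs = partition-All pqs
    in x ∷ ys , zs , refl ∷ σ , x ∷ʳ τ , cong suc len , px ∷ ps , qs
  partition-All {x ∷ _} (inj₂ qx ∷ pqs) =
    let ys , zs , σ , τ , len , ps , qs = partition-All pqs
    in ys , x ∷ zs , x ∷ʳ σ , refl ∷ τ , trans (cong suc len) (sym (+-suc _ _)) , ps , qx ∷ qs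

All-∃⇒∃-All : ∀ {A : Set} {P : ℕ → Set} {Q : ℕ → A → Set} → (∀ {d d′ x} → d ≤ d′ → Q d x → Q d′ x) →
              P 0 → ∀ {xs} → All (λ x → ∃[ d ] P d × Q d x) xs → ∃[ R ] P R × All (Q R) xs
All-∃⇒∃-All Q-mono p₀ [] = 0 , p₀ , []
All-∃⇒∃-All {P = P} Q-mono p₀ ((d , pd , qd) ∷ ws) =
  let R , pR , qs = All-∃⇒∃-All Q-mono p₀ ws
  in d ⊔ R
   , [ (λ eq → subst P (sym eq) pd) , (λ eq → subst P (sym eq) pR) ]′ (⊔-sel d R)
   , Q-mono (m≤m⊔n d R) qd ∷ All.map (Q-mono (m≤n⊔m d R)) qs

AtMost : {A : Set} → (A → Set) → ℕ → Set
AtMost {A} P B = ∀ (xs : List A) → Unique xs → All P xs → length xs ≤ B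

module _ {A : Set} where

  atMost-mono : ∀ {P Q : A → Set} {a b} → (∀ {x} → P x → Q x) → a ≤ b → AtMost Q a → AtMost P b
  atMost-mono P⇒Q a≤b atMostQ xs u ps = ≤-trans (atMostQ xs u (All.map P⇒Q ps)) a≤b

  atMost-≡ : ∀ (y : A) → AtMost (_≡ y) 1
  atMost-≡ y []          _                  _                 = z≤n
  atMost-≡ y (_ ∷ [])    _                  _                 = s≤s z≤n
  atMost-≡ y (_ ∷ _ ∷ _) ((x≢x′ ∷ _) ∷ _)    (refl ∷ refl ∷ _) = ⊥-elim (x≢x′ refl)

  atMost-∪ : ∀ {P Q : A → Set} {a b} → AtMost P a → AtMost Q b → AtMost (P ∪ Q) (a + b)
  atMost-∪ {a = a} {b} atMostP atMostQ xs u pqs =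
    let ys , zs , σ , τ , len , ps , qs = partition-All pqs
    in begin
      length xs              ≡⟨ len ⟩
      length ys + length zs  ≤⟨ +-mono-≤ (atMostP ys (Unique-resp-⊆ σ u) ps)
                                         (atMostQ zs (Unique-resp-⊆ τ u) qs) ⟩
      a + b                  ∎
    where open ≤-Reasoning

  atMost-⋃ : ∀ {I : Set} {P : I → A → Set} {b} → (∀ i → AtMost (P i) b) →
             ∀ is → AtMost (λ x → Any (λ i → P i x) is) (length is * b)
  atMost-⋃ atMostP []       []      _ []       = z≤n
  atMost-⋃ atMostP []       (_ ∷ _) _ (() ∷ _)
  atMost-⋃ atMostP (i ∷ is) = atMost-mono Any.toSum ≤-refl (atMost-∪ (atMostP i) (atMost-⋃ atMostP is))

  atMost-∃ : ∀ {I : Set} {C : I → Set} {P : I → A → Set} {a b} → DecidableEquality I →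
             AtMost C a → (∀ i → AtMost (P i) b) → AtMost (λ x → ∃[ i ] C i × P i x) (a * b)
  atMost-∃ {C = C} {P} {b = b} _≟ᴵ_ atMostC atMostP xs u ws =
    let is , cs , anys = witnesses ws
        is′ = deduplicate _≟ᴵ_ is
    in ≤-trans (atMost-⋃ atMostP is′ xs u (All.map (Any.deduplicate⁺ _≟ᴵ_ λ { refl p → p }) anys))
               (*-monoˡ-≤ b (atMostC is′ (Unique.deduplicate-! _≟ᴵ_ is) (All.deduplicate⁺ _≟ᴵ_ cs)))
    where
    witnesses : ∀ {xs} → All (λ x → ∃[ i ] C i × P i x) xs →
                ∃[ is ] All C is × All (λ x → Any (λ i → P i x) is) xs
    witnesses [] = [] , [] , []
    witnesses ((i , ci , pix) ∷ ws) =
      let is , cs , anys = witnesses ws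
      in i ∷ is , ci ∷ cs , here pix ∷ All.map there anys

module _ {n} (G : Graph n) where

  snocWalk : ∀ {u v w ℓ} → Walk G u v ℓ → E G v w → Walk G u w (suc ℓ)
  snocWalk here       e = step e here
  snocWalk (step e p) f = step e (snocWalk p f)

  reverseWalk : ∀ {u v ℓ} → Walk G u v ℓ → Walk G v u ℓ
  reverseWalk here       = here
  reverseWalk (step e p) = snocWalk (reverseWalk p) (E-sym G e)

  appendWalk : ∀ {u v w ℓ ℓ′} → Walk G u v ℓ → Walk G v w ℓ′ → Walk G u w (ℓ + ℓ′)
  appendWalk here       q = q
  appendWalk (step e p) q = step e (appendWalk p q)

  DistLe-sym : ∀ {u v d} → DistLe G u v d → DistLe G v u d
  DistLe-sym (ℓ , ℓ≤d , p) = ℓ , ℓ≤d , reverseWalk p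

  DistLe-trans : ∀ {u v w d d′} → DistLe G u v d → DistLe G v w d′ → DistLe G u w (d + d′)
  DistLe-trans (ℓ , ℓ≤d , p) (ℓ′ , ℓ′≤d′ , q) = ℓ + ℓ′ , +-mono-≤ ℓ≤d ℓ′≤d′ , appendWalk p q

  DistLe-mono : ∀ {u v d d′} → d ≤ d′ → DistLe G u v d → DistLe G u v d′
  DistLe-mono d≤d′ (ℓ , ℓ≤d , p) = ℓ , ≤-trans ℓ≤d d≤d′ , p

  DistLe-zero : ∀ {u v} → DistLe G u v 0 → v ≡ u
  DistLe-zero (zero , _ , here) = refl

  DistLe-suc : ∀ {u v d} → DistLe G u v (suc d) → v ≡ u ⊎ ∃[ w ] E G u w × DistLe G w v d
  DistLe-suc (zero  , _       , here)     = inj₁ refl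
  DistLe-suc (suc ℓ , s≤s ℓ≤d , step e p) = inj₂ (_ , e , ℓ , ℓ≤d , p)

  NearEdge : ℕ → Fin n × Fin n → Fin n → Set
  NearEdge ρ e v = DistLe G (proj₁ e) v ρ ⊎ DistLe G (proj₂ e) v ρ

  NearEdge-mono : ∀ {ρ ρ′ e v} → ρ ≤ ρ′ → NearEdge ρ e v → NearEdge ρ′ e v
  NearEdge-mono ρ≤ρ′ = Data.Sum.map (DistLe-mono ρ≤ρ′) (DistLe-mono ρ≤ρ′)

geomSum : ℕ → ℕ → ℕ
geomSum Δ zero    = 1
geomSum Δ (suc ρ) = 1 + Δ * geomSum Δ ρ

geomSum<^suc : ∀ {Δ} → 1 < Δ → ∀ ρ → geomSum Δ ρ < Δ ^ suc ρ
geomSum<^suc {Δ} 1<Δ zero    = subst (1 <_) (sym (*-identityʳ Δ)) 1<Δ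
geomSum<^suc {Δ} 1<Δ (suc ρ) = begin-strict
  1 + Δ * geomSum Δ ρ    <⟨ +-monoˡ-< _ 1<Δ ⟩
  Δ + Δ * geomSum Δ ρ    ≡⟨ sym (*-suc Δ _) ⟩
  Δ * suc (geomSum Δ ρ)  ≤⟨ *-monoʳ-≤ Δ (geomSum<^suc 1<Δ ρ) ⟩
  Δ * Δ ^ suc ρ          ∎
  where open ≤-Reasoning

ball-atMost : ∀ {n Δ} {G : Graph n} → MaxDegLe G Δ → ∀ ρ u → AtMost (λ v → DistLe G u v ρ) (geomSum Δ ρ)
ball-atMost {G = G} maxDeg zero    u = atMost-mono (DistLe-zero G) ≤-refl (atMost-≡ u)
ball-atMost {G = G} maxDeg (suc ρ) u =
  atMost-mono (DistLe-suc G) ≤-refl (atMost-∪ (atMost-≡ u) (atMost-∃ _≟_ (maxDeg u) (ball-atMost maxDeg ρ)))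

DistLe-image : ∀ {m n} {H : Graph m} {G : Graph n} ((f , _ , f-adj) : InducedCopy H G) →
               ∀ {i j d} → DistLe H i j d → DistLe G (f i) (f j) d
DistLe-image {G = G} (f , _ , f-adj) (ℓ , ℓ≤d , p) = ℓ , ℓ≤d , mapWalk p
  where
  mapWalk : ∀ {i j ℓ} → Walk _ i j ℓ → Walk G (f i) (f j) ℓ
  mapWalk here       = here
  mapWalk (step e p) = step (proj₁ (f-adj _ _) e) (mapWalk p)

module _ {n} (G : Graph n) (F : List (Fin n × Fin n)) where

  Endpoint : Fin n → Fin n × Fin n → Set
  Endpoint v e = v ≡ proj₁ e ⊎ v ≡ proj₂ e

  InducedCopy-deleteEdges : ∀ {m} {H : Graph m} ((f , _ , _) : InducedCopy H G) →
                            (∀ i → ¬ Any (Endpoint (f i)) F) → InducedCopy H (deleteEdges G F)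
  InducedCopy-deleteEdges (f , f-inj , f-adj) untouched = f , f-inj , λ i j →
      (λ e → proj₁ (f-adj i j) e
           , (λ ij∈F → untouched i (Any.map (λ eq → inj₁ (cong proj₁ eq)) ij∈F))
           , (λ ji∈F → untouched i (Any.map (λ eq → inj₂ (cong proj₂ eq)) ji∈F)))
    , (λ (e , _ , _) → proj₂ (f-adj i j) e)

  InducedCopy-hits : ∀ {ℋ m} {H : Graph m} → Free ℋ (deleteEdges G F) → (m , H) ∈ ℋ →
                     ((f , _) : InducedCopy H G) → ∃[ i ] Any (Endpoint (f i)) F
  InducedCopy-hits {H = H} free H∈ℋ c@(f , _)
    with Fin-any? (λ i → Any.any? (λ e → (f i ≟ proj₁ e) ⊎-dec (f i ≟ proj₂ e)) F)
  ... | yes hit  = hit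
  ... | no  miss = ⊥-elim (free H H∈ℋ (InducedCopy-deleteEdges {H = H} c (λ i hit → miss (i , hit))))

  VH-near : ∀ {ℋ D} → (∀ {m} (H : Graph m) → (m , H) ∈ ℋ → DiamLe H D) →
            Free ℋ (deleteEdges G F) → ∀ {w} → InVH ℋ G w → Any (λ e → NearEdge G D e w) F
  VH-near {D = D} diam free (_ , H , H∈ℋ , c@(f , _) , i , refl) =
    let j , hit = InducedCopy-hits free H∈ℋ c
        fj-near = DistLe-image c (diam H H∈ℋ j i)
        move : ∀ {x} → f j ≡ x → DistLe G x (f i) D
        move eq = subst (λ x → DistLe G x (f i) D) eq fj-near
    in Any.map (Data.Sum.map move move) hit

  kept-near : ∀ {ℋ Δ k D} → (∀ {m} (H : Graph m) → (m , H) ∈ ℋ → DiamLe H D) →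
              Free ℋ (deleteEdges G F) → ∀ {v} → Kept ℋ G Δ k D v →
              ∃[ d ] ¬ TooFar Δ k D d × Any (λ e → NearEdge G (D + d) e v) F
  kept-near {D = D} diam free {v} (d , w , w∈VH , v~w , notFar) =
    let extend : ∀ {x} → DistLe G x w D → DistLe G x v (D + d)
        extend x~w = DistLe-trans G x~w (DistLe-sym G v~w)
    in d , notFar , Any.map (Data.Sum.map extend extend) (VH-near diam free w∈VH)

  edgeBalls-atMost : ∀ {Δ k} → 1 < Δ → MaxDegLe G Δ → length F ≤ k →
                     ∀ ρ → AtMost (λ v → Any (λ e → NearEdge G ρ e v) F) (2 * k * Δ ^ suc ρ)
  edgeBalls-atMost {Δ} {k} 1<Δ maxDeg |F|≤k ρ =
    atMost-mono id bound
      (atMost-⋃ (λ e → atMost-∪ (ball-atMost maxDeg ρ (proj₁ e)) (ball-atMost maxDeg ρ (proj₂ e))) F)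
    where
    geomSum≤ : geomSum Δ ρ ≤ Δ ^ suc ρ
    geomSum≤ = <⇒≤ (geomSum<^suc 1<Δ ρ)
    double : ∀ k x → k * (x + x) ≡ 2 * k * x
    double = solve-∀
    bound : length F * (geomSum Δ ρ + geomSum Δ ρ) ≤ 2 * k * Δ ^ suc ρ
    bound = begin
      length F * (geomSum Δ ρ + geomSum Δ ρ) ≤⟨ *-mono-≤ |F|≤k (+-mono-≤ geomSum≤ geomSum≤) ⟩
      k * (Δ ^ suc ρ + Δ ^ suc ρ)             ≡⟨ double k (Δ ^ suc ρ) ⟩
      2 * k * Δ ^ suc ρ                       ∎
      where open ≤-Reasoning

^-distribʳ-* : ∀ m n o → (m * n) ^ o ≡ m ^ o * n ^ o
^-distribʳ-* m n zero    = refl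
^-distribʳ-* m n (suc o) = begin
  m * n * (m * n) ^ o         ≡⟨ cong (m * n *_) (^-distribʳ-* m n o) ⟩
  m * n * (m ^ o * n ^ o)     ≡⟨ [m*n]*[o*p]≡[m*o]*[n*p] m n (m ^ o) (n ^ o) ⟩
  m * m ^ o * (n * n ^ o)     ∎
  where open ≡-Reasoning

[c*y^a]^s≡c^s*y^[a*s] : ∀ c y a s → (c * y ^ a) ^ s ≡ c ^ s * y ^ (a * s)
[c*y^a]^s≡c^s*y^[a*s] c y a s = trans (^-distribʳ-* c (y ^ a) s) (cong (c ^ s *_) (^-*-assoc y a s))

^-cancel-sandwich : ∀ {x y c} j t .{{_ : NonZero x}} →
                    x ^ (j + t) ≤ c * y ^ (j + t) → c * y ^ j ≤ x ^ j → x ^ t ≤ y ^ t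
^-cancel-sandwich {x} {y} {c} j t upper lower = *-cancelˡ-≤ (x ^ j) {{m^n≢0 x j}} (begin
  x ^ j * x ^ t            ≡⟨ sym (^-distribˡ-+-* x j t) ⟩
  x ^ (j + t)              ≤⟨ upper ⟩
  c * y ^ (j + t)          ≡⟨ cong (c *_) (^-distribˡ-+-* y j t) ⟩
  c * (y ^ j * y ^ t)      ≡⟨ sym (*-assoc c (y ^ j) (y ^ t)) ⟩
  c * y ^ j * y ^ t        ≤⟨ *-monoˡ-≤ (y ^ t) lower ⟩
  x ^ j * y ^ t            ∎)
  where open ≤-Reasoning

-- The hypotheses say i ≤ log_(x/y) c ≤ j.
^-sandwich⇒≤ : ∀ {x y c i j} → y < x → x ^ i ≤ c * y ^ i → c * y ^ j ≤ x ^ j → i ≤ j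
^-sandwich⇒≤ {x} {y} {c} {i} {j} y<x upper lower = ≮⇒≥ λ j<i →
  let t = i ∸ j
      instance
        x≢0 : NonZero x
        x≢0 = >-nonZero (m<n⇒0<n y<x)
        t≢0 : NonZero t
        t≢0 = >-nonZero (m<n⇒0<n∸m j<i)
      upper′ = subst (λ e → x ^ e ≤ c * y ^ e) (sym (m+[n∸m]≡n (<⇒≤ j<i))) upper
  in <⇒≱ (^-monoˡ-< t y<x) (^-cancel-sandwich {c = c} j t upper′ lower)

-- With b = 2Δ/(2Δ−1): ¬ TooFar says R ≤ D (1 + log_b k), and k^s (2Δ−1)^r ≤ (2Δ)^r says log_b k ≤ r/s.
¬TooFar⇒≤ : ∀ {Δ k D R r s} → 0 < Δ → ¬ TooFar Δ k D R →
            k ^ s * (2 * Δ ∸ 1) ^ r ≤ (2 * Δ) ^ r → R * s ≤ D * r + D * s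
¬TooFar⇒≤ {Δ} {k} {D} {R} {r} {s} 0<Δ notFar k^s≤b^r with D <? R
... | no  D≮R = ≤-trans (*-monoˡ-≤ s (≮⇒≥ D≮R)) (m≤n+m (D * s) (D * r))
... | yes D<R = begin
  R * s          ≡⟨ cong (_* s) (sym (m∸n+n≡m (<⇒≤ D<R))) ⟩
  (a + D) * s    ≡⟨ *-distribʳ-+ s a D ⟩
  a * s + D * s  ≤⟨ +-monoˡ-≤ (D * s) (^-sandwich⇒≤ {c = k ^ (D * s)} y<x upper lower) ⟩
  r * D + D * s  ≡⟨ cong (_+ D * s) (*-comm r D) ⟩
  D * r + D * s  ∎
  where
  open ≤-Reasoning
  x = 2 * Δ
  y = 2 * Δ ∸ 1
  a = R ∸ D
  y<x : y < x
  y<x = ∸-monoʳ-< (s≤s z≤n) (≤-trans 0<Δ (m≤n*m Δ 2))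
  upper : x ^ (a * s) ≤ k ^ (D * s) * y ^ (a * s)
  upper = subst₂ _≤_ (^-*-assoc x a s)
                     (trans ([c*y^a]^s≡c^s*y^[a*s] (k ^ D) y a s) (cong (_* y ^ (a * s)) (^-*-assoc k D s)))
                     (^-monoˡ-≤ s (≮⇒≥ λ far → notFar (D<R , far)))
  lower : k ^ (D * s) * y ^ (r * D) ≤ x ^ (r * D)
  lower = subst₂ _≤_ (trans ([c*y^a]^s≡c^s*y^[a*s] (k ^ s) y r D)
                            (cong (_* y ^ (r * D)) (trans (^-*-assoc k s D) (cong (k ^_) (*-comm s D)))))
                     (^-*-assoc x r D)
                     (^-monoˡ-≤ D k^s≤b^r)

BoundHolds-intro : ∀ {Δ k D R N} → 1 < Δ → ¬ TooFar Δ k D R → N ≤ 2 * k * Δ ^ suc (D + R) →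
                   BoundHolds Δ k D N
BoundHolds-intro {Δ} {k} {D} {R} {N} 1<Δ notFar N≤ r s _ N^s>bound = ≰⇒> λ k^s≤b^r → <⇒≱ N^s>bound (begin
  N ^ s                                                ≤⟨ ^-monoˡ-≤ s N≤ ⟩
  (2 * k * Δ ^ suc (D + R)) ^ s                        ≡⟨ [c*y^a]^s≡c^s*y^[a*s] (2 * k) Δ (suc (D + R)) s ⟩
  (2 * k) ^ s * Δ ^ (suc (D + R) * s)                  ≤⟨ *-monoʳ-≤ ((2 * k) ^ s) (^-monoʳ-≤ Δ (exponent k^s≤b^r)) ⟩
  (2 * k) ^ s * Δ ^ (D * r + (2 * D + 1) * s)          ≡⟨ cong ((2 * k) ^ s *_) (^-distribˡ-+-* Δ (D * r) _) ⟩
  (2 * k) ^ s * (Δ ^ (D * r) * Δ ^ ((2 * D + 1) * s))  ≡⟨ x∙yz≈y∙xz ((2 * k) ^ s) (Δ ^ (D * r)) _ ⟩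
  Δ ^ (D * r) * ((2 * k) ^ s * Δ ^ ((2 * D + 1) * s))  ≡⟨ cong (Δ ^ (D * r) *_) (sym ([c*y^a]^s≡c^s*y^[a*s] (2 * k) Δ (2 * D + 1) s)) ⟩
  Δ ^ (D * r) * (2 * k * Δ ^ (2 * D + 1)) ^ s          ≡⟨ cong (λ z → Δ ^ (D * r) * z ^ s) (xy∙z≈xz∙y 2 k (Δ ^ (2 * D + 1))) ⟩
  Δ ^ (D * r) * (2 * Δ ^ (2 * D + 1) * k) ^ s          ∎)
  where
  open ≤-Reasoning
  instance
    Δ≢0 : NonZero Δ
    Δ≢0 = >-nonZero (m<n⇒0<n 1<Δ)
  distribute : ∀ D R s → suc (D + R) * s ≡ s + D * s + R * s
  distribute = solve-∀
  collect : ∀ D r s → s + D * s + (D * r + D * s) ≡ D * r + (2 * D + 1) * s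
  collect = solve-∀
  exponent : k ^ s * (2 * Δ ∸ 1) ^ r ≤ (2 * Δ) ^ r → suc (D + R) * s ≤ D * r + (2 * D + 1) * s
  exponent k^s≤b^r = begin
    suc (D + R) * s               ≡⟨ distribute D R s ⟩
    s + D * s + R * s             ≤⟨ +-monoʳ-≤ (s + D * s) (¬TooFar⇒≤ (m<n⇒0<n 1<Δ) notFar k^s≤b^r) ⟩
    s + D * s + (D * r + D * s)   ≡⟨ collect D r s ⟩
    D * r + (2 * D + 1) * s       ∎

-- The hypotheses 1 ≤ k and V_ℋ(G) ≠ ∅ only exclude instances where G' is empty.
lemma7 : (ℋ : Family) (D Δ k : ℕ) →
         (∀ {m} (H : Graph m) → (m , H) ∈ ℋ → Connected H × DiamLe H D) →
         2 ≤ Δ → 1 ≤ k →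
         ∀ {n} (G : Graph n) → MaxDegLe G Δ → YesInstance ℋ G k →
         (∃[ v ] InVH ℋ G v) →
         ∀ (l : List (Fin n)) → Unique l → All (Kept ℋ G Δ k D) l →
         BoundHolds Δ k D (length l)
lemma7 ℋ D Δ k diam 1<Δ _ G maxDeg (F , _ , |F|≤k , free) _ l unique kept =
  let R , notFar , near = All-∃⇒∃-All (λ d≤d′ → Any.map (NearEdge-mono G (+-monoʳ-≤ D d≤d′)))
                                       (λ { (() , _) })
                                       (All.map (kept-near G F {Δ = Δ} {k} (λ H H∈ℋ → proj₂ (diam H H∈ℋ)) free) kept)
  in BoundHolds-intro 1<Δ notFar (edgeBalls-atMost G F 1<Δ maxDeg |F|≤k (D + R) l unique near)
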